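{- Let $q\ge 1$, $\Sigma=\{0,1,\ldots,q-1\}$, and let $n\ge 2$ be even. Then for every $T\in BBF_n^q$ we have $\psi(T)\subseteq BBF_{n+1}^q$; for distinct $T_1,T_2\in BBF_n^q$ we have $\psi(T_1)\cap\psi(T_2)=\emptyset$; and $BBF_{n+1}^q=\bigcup_{T\in BBF_n^q}\psi(T)$. In other words, the sets $\psi(T)$, $T\in BBF_n^q$, form a partition of $BBF_{n+1}^q$.
   Context: For an $m\times m$ matrix $T$ over $\Sigma$ and $1\le r<m$, the $r\times r$ biprefix of $T$ is $T[1\ldots r,1\ldots r]$ and the $r\times r$ bisuffix is $T[m-r+1\ldots m,\,m-r+1\ldots m]$. $T$ is bibifix-free if for no $1\le r<m$ the $r\times r$ biprefix equals the $r\times r$ bisuffix. $BBF_m^q$ denotes the set of all $m\times m$ bibifix-free matrices over $\Sigma$. For an $n\times n$ matrix $M$ over $\Sigma$, let $h=\lfloor n/2\rfloor$; $\psi(M)$ is the set of all $(n+1)\times(n+1)$ matrices $T'$ over $\Sigma$ obtained by inserting into $M$ a new row and a new column, both at position $h+1$, with arbitrary entries from $\Sigma$; precisely, $T'[i,j]=M[\iota(i),\iota(j)]$ for all $i,j\neq h+1$, where $\iota(i)=i$ if $i\le h$ and $\iota(i)=i-1$ if $i\ge h+2$, while the entries of row $h+1$ and column $h+1$ of $T'$ are arbitrary. -}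

module Defs where

open import Data.Nat using (ℕ; suc; _+_; _∸_; _≤_; _<_; s≤s; ⌊_/2⌋)
open import Data.Nat.Properties using (⌊n/2⌋≤n)
open import Data.Fin using (Fin; toℕ; fromℕ<; punchIn)
open import Data.Product using (_×_)
open import Relation.Binary.PropositionalEquality using (_≡_)
open import Relation.Nullary using (¬_)

-- Σ = {0,…,q-1} is Fin q.  An m×m matrix over Σ, indices 0-based.
Matrix : ℕ → ℕ → Set
Matrix q m = Fin m → Fin m → Fin q

_≈ᴹ_ : ∀ {q m} → Matrix q m → Matrix q m → Set
A ≈ᴹ B = ∀ i j → A i j ≡ B i j

BiprefixEqBisuffix : ∀ {q m} → Matrix q m → ℕ → Set
BiprefixEqBisuffix {q} {m} T r =
  ∀ (i j a b : Fin m) → toℕ i < r → toℕ j < r →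
  toℕ a ≡ (m ∸ r) + toℕ i → toℕ b ≡ (m ∸ r) + toℕ j →
  T i j ≡ T a b

BibifixFree : ∀ {q m} → Matrix q m → Set
BibifixFree {q} {m} T = ∀ r → 1 ≤ r → r < m → ¬ BiprefixEqBisuffix T r

-- 0-based position h = ⌊n/2⌋ of the inserted row/column (1-based h+1).
midIdx : (n : ℕ) → Fin (suc n)
midIdx n = fromℕ< (s≤s (⌊n/2⌋≤n n))

-- T' ∈ ψ(M): deleting row and column h of T' yields M, i.e.
-- T'[ι⁻¹ i, ι⁻¹ j] = M[i,j] where ι⁻¹ = punchIn h (insertion at position h).
InPsi : ∀ {q n} → Matrix q n → Matrix q (suc n) → Set
InPsi {q} {n} M T' =
  ∀ (i j : Fin n) → T' (punchIn (midIdx n) i) (punchIn (midIdx n) j) ≡ M i j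

module Submission where

-- Write m for the size of a matrix T.  A common r×r biprefix and
-- bisuffix is the same thing as a diagonal period p = m ∸ r: T[i,j] = T[i+p,j+p]
-- whenever both entries exist.  So T is bibifix-free iff it has no period p with
-- 1 ≤ p < m.  Periods add, and doubling a period until it exceeds m/2 shows that
-- it even suffices to exclude the "long" periods p < m with m ≤ 2p.
--
-- For n = 2k the inserted row/column sits at index k.  A long period of an
-- (2k+1)×(2k+1) matrix T' has the form t+1 with k ≤ t, a long period of a
-- 2k×2k matrix has the form t with k ≤ t, and such a shift always moves an index
-- below the middle to one at or above it.  Hence for T' ∈ ψ(M), t+1 is a period
-- of T' iff t is a period of M (for k ≤ t), which gives both ψ(M) ⊆ BBF_{2k+1}
-- for M ∈ BBF_{2k} and that deleting the middle row and column of a matrix in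
-- BBF_{2k+1} lands in BBF_{2k}.  Disjointness holds because deleting the middle
-- row and column recovers M from any T' ∈ ψ(M).

open import Defs
open import Data.Nat using (ℕ; zero; suc; _+_; _∸_; _≤_; _<_; z≤n; s≤s; _≤?_)
open import Data.Nat.Properties
open import Data.Fin using (Fin; toℕ; fromℕ<; punchIn) renaming (zero to fzero; suc to fsuc)
open import Data.Fin.Properties using (toℕ-fromℕ<; toℕ-injective; toℕ<n)
open import Data.Product using (_×_; Σ; ∃; _,_)
open import Relation.Binary.PropositionalEquality
open import Relation.Nullary using (¬_; yes; no; contradiction)

half-≤ : ∀ {a b} → a + a ≤ b + b → a ≤ b
half-≤ a+a≤b+b = ≮⇒≥ (λ b<a → <⇒≱ (+-mono-< b<a b<a) a+a≤b+b)

half-< : ∀ {a b} → a + a < b + b → a < b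
half-< a+a<b+b = ≰⇒> (λ b≤a → <⇒≱ a+a<b+b (+-mono-≤ b≤a b≤a))

Period : ∀ {q m} → Matrix q m → ℕ → Set
Period {q} {m} T p =
  ∀ (i j a b : Fin m) → toℕ a ≡ p + toℕ i → toℕ b ≡ p + toℕ j → T i j ≡ T a b

border⇒period : ∀ {q m} (T : Matrix q m) r → r ≤ m →
                BiprefixEqBisuffix T r → Period T (m ∸ r)
border⇒period {m = m} T r r≤m border i j a b a≡ b≡ =
  border i j a b (below i a a≡) (below j b b≡) a≡ b≡
  where
  below : ∀ x y → toℕ y ≡ m ∸ r + toℕ x → toℕ x < r
  below x y y≡ = +-cancelˡ-< (m ∸ r) (toℕ x) r
    (subst₂ _<_ y≡ (sym (m∸n+n≡m r≤m)) (toℕ<n y))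

bbf⇒aperiodic : ∀ {q m} (T : Matrix q m) → BibifixFree T →
                ∀ p → 1 ≤ p → p < m → ¬ Period T p
bbf⇒aperiodic {m = m} T bbf p 1≤p p<m period =
  bbf (m ∸ p) (m<n⇒0<n∸m p<m) (∸-monoʳ-< 1≤p (<⇒≤ p<m))
      (λ i j a b _ _ a≡ b≡ → period i j a b (rewrite-shift a≡) (rewrite-shift b≡))
  where
  rewrite-shift : ∀ {x y} → x ≡ m ∸ (m ∸ p) + y → x ≡ p + y
  rewrite-shift {y = y} x≡ = trans x≡ (cong (_+ y) (m∸[m∸n]≡n (<⇒≤ p<m)))

period-+ : ∀ {q m} (T : Matrix q m) p p' → Period T p → Period T p' → Period T (p + p')
period-+ {m = m} T p p' period period' i j a b a≡ b≡ =
  trans (period i j (mid i a a≡) (mid j b b≡) (toℕ-fromℕ< _) (toℕ-fromℕ< _))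
        (period' (mid i a a≡) (mid j b b≡) a b (via-mid i a a≡) (via-mid j b b≡))
  where
  mid< : ∀ x y → toℕ y ≡ p + p' + toℕ x → p + toℕ x < m
  mid< x y y≡ = ≤-<-trans (+-monoˡ-≤ (toℕ x) (m≤m+n p p')) (subst (_< m) y≡ (toℕ<n y))
  mid : ∀ x y → toℕ y ≡ p + p' + toℕ x → Fin m
  mid x y y≡ = fromℕ< (mid< x y y≡)
  via-mid : ∀ x y y≡ → toℕ y ≡ p' + toℕ (mid x y y≡)
  via-mid x y y≡ = begin
    toℕ y                   ≡⟨ y≡ ⟩
    p + p' + toℕ x          ≡⟨ cong (_+ toℕ x) (+-comm p p') ⟩
    p' + p + toℕ x          ≡⟨ +-assoc p' p (toℕ x) ⟩
    p' + (p + toℕ x)        ≡⟨ cong (p' +_) (sym (toℕ-fromℕ< (mid< x y y≡))) ⟩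
    p' + toℕ (mid x y y≡)   ∎
    where open ≡-Reasoning

-- Doubling a period p (1 ≤ p < m) until it exceeds m/2 yields a long period.
-- The fuel f bounds the number of doublings still needed.
double-to-long : ∀ {q m} (T : Matrix q m) f p → m ≤ p + f → 1 ≤ p → p < m → Period T p →
                 ∃ λ s → s < m × m ≤ s + s × Period T s
double-to-long {m = m} T f p m≤p+f 1≤p p<m period with m ≤? p + p
... | yes m≤p+p = p , p<m , m≤p+p , period
double-to-long {m = m} T zero p m≤p+0 1≤p p<m period | no _ =
  contradiction (subst (m ≤_) (+-identityʳ p) m≤p+0) (<⇒≱ p<m)
double-to-long {m = m} T (suc f) p m≤p+f 1≤p p<m period | no m≰p+p =
  double-to-long T f (p + p) m≤2p+f (≤-trans 1≤p (m≤m+n p p)) (≰⇒> m≰p+p)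
                 (period-+ T p p period period)
  where
  m≤2p+f : m ≤ p + p + f
  m≤2p+f = ≤-trans m≤p+f (≤-trans (≤-reflexive (+-suc p f))
             (+-monoˡ-≤ f (subst (_≤ p + p) (+-comm p 1) (+-monoʳ-≤ p 1≤p))))

long-period : ∀ {q m} (T : Matrix q m) p → 1 ≤ p → p < m → Period T p →
              ∃ λ s → s < m × m ≤ s + s × Period T s
long-period {m = m} T p = double-to-long T m p (m≤n+m m p)

noLongPeriod⇒bbf : ∀ {q m} (T : Matrix q m) →
                   (∀ s → s < m → m ≤ s + s → ¬ Period T s) → BibifixFree T
noLongPeriod⇒bbf {m = m} T noLong r 1≤r r<m border
  with long-period T (m ∸ r) (m<n⇒0<n∸m r<m) (∸-monoʳ-< 1≤r (<⇒≤ r<m))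
                   (border⇒period T r (<⇒≤ r<m) border)
... | s , s<m , m≤s+s , period = noLong s s<m m≤s+s period

punchIn-below : ∀ {n} (h : Fin (suc n)) (x : Fin n) → toℕ x < toℕ h →
                toℕ (punchIn h x) ≡ toℕ x
punchIn-below fzero    x         ()
punchIn-below (fsuc h)   fzero   _         = refl
punchIn-below (fsuc h)   (fsuc x)   (s≤s x<h) = cong suc (punchIn-below h x x<h)

punchIn-above : ∀ {n} (h : Fin (suc n)) (x : Fin n) → toℕ h ≤ toℕ x →
                toℕ (punchIn h x) ≡ suc (toℕ x)
punchIn-above fzero  x        _         = refl
punchIn-above (fsuc h) (fsuc x) (s≤s h≤x) = cong suc (punchIn-above h x h≤x)

punchIn-onto-below : ∀ {n} (h : Fin (suc n)) (x' : Fin (suc n)) → toℕ x' < toℕ h →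
                     ∃ λ x → toℕ x ≡ toℕ x' × punchIn h x ≡ x'
punchIn-onto-below {n} h x' x'<h =
  x , toℕ-fromℕ< x'<n , toℕ-injective (trans (punchIn-below h x x<h) (toℕ-fromℕ< x'<n))
  where
  x'<n : toℕ x' < n
  x'<n = <-≤-trans x'<h (≤-pred (toℕ<n h))
  x = fromℕ< x'<n
  x<h : toℕ x < toℕ h
  x<h = subst (_< toℕ h) (sym (toℕ-fromℕ< x'<n)) x'<h

punchIn-onto-above : ∀ {n} (h : Fin (suc n)) (y' : Fin (suc n)) → toℕ h < toℕ y' →
                     ∃ λ y → suc (toℕ y) ≡ toℕ y' × punchIn h y ≡ y'
punchIn-onto-above h (fsuc y) (s≤s h≤y) =
  y , refl , toℕ-injective (punchIn-above h y h≤y)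

shift-starts-below : ∀ {m} c s (x y : Fin m) → m ≤ c + s → toℕ y ≡ s + toℕ x → toℕ x < c
shift-starts-below {m} c s x y m≤c+s y≡ = +-cancelˡ-< s (toℕ x) c
  (<-≤-trans (subst (_< m) y≡ (toℕ<n y)) (≤-trans m≤c+s (≤-reflexive (+-comm c s))))

middle≡ : ∀ k → toℕ (midIdx (k + k)) ≡ k
middle≡ k = trans (toℕ-fromℕ< _) (sym (n≡⌊n+n/2⌋ k))

punchIn-shift : ∀ k t (x y : Fin (k + k)) → k ≤ t → toℕ y ≡ t + toℕ x →
                toℕ (punchIn (midIdx (k + k)) y) ≡ suc t + toℕ (punchIn (midIdx (k + k)) x)
punchIn-shift k t x y k≤t y≡ = begin
  toℕ (punchIn h y)          ≡⟨ punchIn-above h y h≤y ⟩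
  suc (toℕ y)                ≡⟨ cong suc y≡ ⟩
  suc t + toℕ x              ≡⟨ cong (suc t +_) (sym (punchIn-below h x x<h)) ⟩
  suc t + toℕ (punchIn h x)  ∎
  where
  open ≡-Reasoning
  h = midIdx (k + k)
  x<h : toℕ x < toℕ h
  x<h = subst (toℕ x <_) (sym (middle≡ k))
          (shift-starts-below k t x y (+-monoʳ-≤ k k≤t) y≡)
  h≤y : toℕ h ≤ toℕ y
  h≤y = subst₂ _≤_ (sym (middle≡ k)) (sym y≡) (≤-trans k≤t (m≤m+n t (toℕ x)))

period-deletion : ∀ {q} k (M : Matrix q (k + k)) (T' : Matrix q (suc (k + k))) → InPsi M T' →
                  ∀ t → k ≤ t → Period T' (suc t) → Period M t
period-deletion k M T' ψ t k≤t period i j a b a≡ b≡ = begin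
  M i j                ≡⟨ sym (ψ i j) ⟩
  T' (pI i) (pI j)     ≡⟨ period (pI i) (pI j) (pI a) (pI b)
                                 (punchIn-shift k t i a k≤t a≡) (punchIn-shift k t j b k≤t b≡) ⟩
  T' (pI a) (pI b)     ≡⟨ ψ a b ⟩
  M a b                ∎
  where
  open ≡-Reasoning
  pI = punchIn (midIdx (k + k))

-- Both ends of a shift by t+1 ≥ k+1 in T' avoid the middle, so they come from M,
-- where they differ by t.
shift-preimages : ∀ k t → k ≤ t → (x' y' : Fin (suc (k + k))) → toℕ y' ≡ suc t + toℕ x' →
                  ∃ λ x → ∃ λ y → toℕ y ≡ t + toℕ x ×
                  punchIn (midIdx (k + k)) x ≡ x' × punchIn (midIdx (k + k)) y ≡ y'
shift-preimages k t k≤t x' y' y'≡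
  with punchIn-onto-below (midIdx (k + k)) x' x'<h | punchIn-onto-above (midIdx (k + k)) y' h<y'
  where
  x'<h : toℕ x' < toℕ (midIdx (k + k))
  x'<h = subst (toℕ x' <_) (sym (middle≡ k))
           (shift-starts-below k (suc t) x' y'
             (subst (suc (k + k) ≤_) (sym (+-suc k t)) (s≤s (+-monoʳ-≤ k k≤t))) y'≡)
  h<y' : toℕ (midIdx (k + k)) < toℕ y'
  h<y' = subst₂ _<_ (sym (middle≡ k)) (sym y'≡) (s≤s (≤-trans k≤t (m≤m+n t (toℕ x'))))
... | x , x≡ , px | y , y≡ , py =
  x , y , suc-injective (trans y≡ (trans y'≡ (cong (suc t +_) (sym x≡)))) , px , py

period-insertion : ∀ {q} k (M : Matrix q (k + k)) (T' : Matrix q (suc (k + k))) → InPsi M T' →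
                   ∀ t → k ≤ t → Period M t → Period T' (suc t)
period-insertion k M T' ψ t k≤t period i' j' a' b' a'≡ b'≡
  with shift-preimages k t k≤t i' a' a'≡ | shift-preimages k t k≤t j' b' b'≡
... | i , a , a≡ , refl , refl | j , b , b≡ , refl , refl = begin
  T' (pI i) (pI j)     ≡⟨ ψ i j ⟩
  M i j                ≡⟨ period i j a b a≡ b≡ ⟩
  M a b                ≡⟨ sym (ψ a b) ⟩
  T' (pI a) (pI b)     ∎
  where
  open ≡-Reasoning
  pI = punchIn (midIdx (k + k))

deleteMiddle : ∀ {q n} → Matrix q (suc n) → Matrix q n
deleteMiddle {n = n} T' i j = T' (punchIn (midIdx n) i) (punchIn (midIdx n) j)

psi-injective : ∀ {q n} {M₁ M₂ : Matrix q n} {T' : Matrix q (suc n)} →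
                InPsi M₁ T' → InPsi M₂ T' → M₁ ≈ᴹ M₂
psi-injective ψ₁ ψ₂ i j = trans (sym (ψ₁ i j)) (ψ₂ i j)

mainTheorem2 : (q n : ℕ) → 1 ≤ q → 2 ≤ n → Σ ℕ (λ k → n ≡ k + k) →
    ((T : Matrix q n) → BibifixFree T →
    (T' : Matrix q (suc n)) → InPsi T T' → BibifixFree T')
    × ((T₁ T₂ : Matrix q n) → BibifixFree T₁ → BibifixFree T₂ → ¬ (T₁ ≈ᴹ T₂) →
    (T' : Matrix q (suc n)) → ¬ (InPsi T₁ T' × InPsi T₂ T'))
    × ((T' : Matrix q (suc n)) → BibifixFree T' →
    ∃ (λ (T : Matrix q n) → BibifixFree T × InPsi T T'))
mainTheorem2 q .(k + k) _ 2≤n (k , refl) = preserves , disjoint , covers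
  where
  1≤k : 1 ≤ k
  1≤k = half-≤ 2≤n
  preserves : (M : Matrix q (k + k)) → BibifixFree M →
              (T' : Matrix q (suc (k + k))) → InPsi M T' → BibifixFree T'
  preserves M bbf T' ψ = noLongPeriod⇒bbf T' noLong
    where
    noLong : ∀ s → s < suc (k + k) → suc (k + k) ≤ s + s → ¬ Period T' s
    noLong (suc t) (s≤s t<n) m≤s+s period =
      bbf⇒aperiodic M bbf t (≤-trans 1≤k k≤t) t<n (period-deletion k M T' ψ t k≤t period)
      where
      k≤t : k ≤ t
      k≤t = ≤-pred (half-< m≤s+s)
  disjoint : (M₁ M₂ : Matrix q (k + k)) → BibifixFree M₁ → BibifixFree M₂ → ¬ (M₁ ≈ᴹ M₂) →
             (T' : Matrix q (suc (k + k))) → ¬ (InPsi M₁ T' × InPsi M₂ T')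
  disjoint _ _ _ _ M₁≉M₂ T' (ψ₁ , ψ₂) = M₁≉M₂ (psi-injective {T' = T'} ψ₁ ψ₂)
  covers : (T' : Matrix q (suc (k + k))) → BibifixFree T' →
           ∃ (λ (M : Matrix q (k + k)) → BibifixFree M × InPsi M T')
  covers T' bbf' = M , noLongPeriod⇒bbf M noLong , ψ
    where
    M = deleteMiddle T'
    ψ : InPsi M T'
    ψ i j = refl
    noLong : ∀ s → s < k + k → k + k ≤ s + s → ¬ Period M s
    noLong s s<n n≤s+s period =
      bbf⇒aperiodic T' bbf' (suc s) (s≤s z≤n) (s≤s s<n)
        (period-insertion k M T' ψ s (half-≤ n≤s+s) period)
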